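{- Let $G$ be a graph with a universal vertex $v$. If $\overline{\operatorname{Z}}(G)=\operatorname{Z}(G)$, then $\overline{\operatorname{Z}}(G-v)=\operatorname{Z}(G-v)$.
   Context: All graphs are finite, simple and undirected. A universal vertex is a vertex adjacent to all other vertices; $G-v$ is the graph obtained by deleting $v$. Given a set $S$ of initially blue vertices (all others white), the zero forcing color change rule says that a blue vertex with exactly one white neighbor causes that neighbor to become blue. $S$ is a zero forcing set if repeatedly applying this rule eventually makes every vertex blue. $\operatorname{Z}(G)$ is the minimum cardinality of a zero forcing set of $G$. A minimal zero forcing set is a zero forcing set containing no other zero forcing set as a proper subset, and $\overline{\operatorname{Z}}(G)$ is the maximum size of a minimal zero forcing set of $G$. -}

module Defs where

open import Data.Nat using (ℕ; suc; _≤_)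
open import Data.Bool using (Bool; true; false)
open import Data.Fin using (Fin; punchIn)
open import Data.Fin.Subset using (Subset; _∈_; _⊂_; ∣_∣)
open import Data.Product using (Σ; _×_; _,_)
open import Relation.Binary.PropositionalEquality using (_≡_; _≢_)
open import Relation.Nullary using (¬_)

record Graph (n : ℕ) : Set where
  field
    adj   : Fin n → Fin n → Bool
    sym   : ∀ u w → adj u w ≡ adj w u
    irref : ∀ u → adj u u ≡ false
open Graph public

Universal : ∀ {n} → Graph n → Fin n → Set
Universal G v = ∀ u → u ≢ v → adj G v u ≡ true

deleteVertex : ∀ {n} → Graph (suc n) → Fin (suc n) → Graph n
deleteVertex G v = record
  { adj   = λ i j → adj G (punchIn v i) (punchIn v j)
  ; sym   = λ i j → sym G (punchIn v i) (punchIn v j)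
  ; irref = λ i → irref G (punchIn v i)
  }

-- Vertices that end up blue starting from S, by repeated application of the
-- zero forcing color change rule: if u is blue and w is the only neighbour of u
-- that is not (yet) blue, then w becomes blue.
data Blue {n} (G : Graph n) (S : Subset n) : Fin n → Set where
  initial : ∀ {x} → x ∈ S → Blue G S x
  force   : ∀ {u w} → Blue G S u → adj G u w ≡ true →
            (∀ y → adj G u y ≡ true → y ≢ w → Blue G S y) →
            Blue G S w

ZeroForcingSet : ∀ {n} → Graph n → Subset n → Set
ZeroForcingSet G S = ∀ x → Blue G S x

MinimalZeroForcingSet : ∀ {n} → Graph n → Subset n → Set
MinimalZeroForcingSet G S =
  ZeroForcingSet G S × (∀ T → T ⊂ S → ¬ ZeroForcingSet G T)

IsZ : ∀ {n} → Graph n → ℕ → Set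
IsZ G k = Σ _ (λ S → ZeroForcingSet G S × ∣ S ∣ ≡ k)
        × (∀ S → ZeroForcingSet G S → k ≤ ∣ S ∣)

IsZbar : ∀ {n} → Graph n → ℕ → Set
IsZbar G k = Σ _ (λ S → MinimalZeroForcingSet G S × ∣ S ∣ ≡ k)
           × (∀ S → MinimalZeroForcingSet G S → ∣ S ∣ ≤ k)

-- Let H = G - v. A zero forcing set of H lifts to one of G and a minimal one to a minimal one,
-- all sizes shifted by the same constant; so a minimal set of H larger than a minimum one would
-- give a minimal set of G larger than some zero forcing set of G, contradicting Z(G) = Zbar(G).
-- The lift depends on the isolated vertices of H, which lie in every zero forcing set of H and
-- are adjacent in G only to v: if there are none, add v; if there is exactly one, z, replace z
-- by v (v then forces z); if there are more, drop one of them, z (another one forces v, which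
-- then forces z). Minimality of the lift rests on the converse transfer: a zero forcing set T of
-- G yields the zero forcing set of H made of the vertices of T and the isolated vertices of H,
-- since a force v → x in G can be replayed in H by any H-neighbour of x.
module Submission where

open import Defs
open import Data.Bool using (Bool; true; false)
open import Data.Bool.Properties using (¬-not) renaming (_≟_ to _≟ᵇ_)
open import Data.Empty using (⊥)
open import Data.Fin using (Fin; zero; suc; punchIn; punchOut; _≟_)
open import Data.Fin.Properties using (punchIn-injective; punchInᵢ≢i; punchIn-punchOut; any?; all?)
open import Data.Fin.Subset using (Subset; _∈_; _∉_; _⊆_; _⊂_; ∣_∣; _-_)
open import Data.Fin.Subset.Properties using (_∈?_; p⊂q⇒∣p∣<∣q∣; p─⊥≡p; p─q⊆p; x∈p∧x≢y⇒x∈p-y)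
open import Data.Nat using (ℕ; suc; _≤_; _<_; s≤s; s≤s⁻¹; _≤?_)
open import Data.Nat.Properties using (≤-refl; ≤-trans; <-≤-trans; <⇒≱; ≮⇒≥)
open import Data.Product using (∃; ∃₂; _×_; _,_; proj₁; proj₂)
open import Data.Sum using (_⊎_; inj₁; inj₂; [_,_]′)
open import Data.Vec using (_∷_; tabulate; insertAt; here; there)
open import Data.Vec.Properties using (lookup∘tabulate; []=⇒lookup; lookup⇒[]=; insertAt-lookup; insertAt-punchIn)
open import Function using (_∘_)
open import Relation.Nullary using (¬_; Dec; yes; no; does; proof; contradiction)
open import Relation.Nullary.Decidable using (dec-true; decidable-stable; _⊎-dec_; _×-dec_; ¬?)
open import Relation.Nullary.Reflects using (Reflects; invert)
open import Relation.Unary using (Decidable)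
open import Relation.Binary.PropositionalEquality
  using (_≡_; _≢_; refl; trans; cong; subst; subst₂; module ≡-Reasoning) renaming (sym to ≡-sym)

subsetOf : ∀ {m} {P : Fin m → Set} → Decidable P → Subset m
subsetOf P? = tabulate (does ∘ P?)

module _ {m} {P : Fin m → Set} (P? : Decidable P) {i : Fin m} where

  ∈-subsetOf⁺ : P i → i ∈ subsetOf P?
  ∈-subsetOf⁺ p = lookup⇒[]= i _ (trans (lookup∘tabulate (does ∘ P?) i) (dec-true (P? i) p))

  ∈-subsetOf⁻ : i ∈ subsetOf P? → P i
  ∈-subsetOf⁻ i∈ = invert (subst (Reflects (P i)) does≡true (proof (P? i)))
    where
    does≡true : does (P? i) ≡ true
    does≡true = trans (≡-sym (lookup∘tabulate (does ∘ P?) i)) ([]=⇒lookup i∈)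

module _ {m} {X : Subset m} {i : Fin (suc m)} {b : Bool} {x : Fin m} where

  punchIn∈insertAt⁺ : x ∈ X → punchIn i x ∈ insertAt X i b
  punchIn∈insertAt⁺ x∈X = lookup⇒[]= _ _ (trans (insertAt-punchIn X i b x) ([]=⇒lookup x∈X))

  punchIn∈insertAt⁻ : punchIn i x ∈ insertAt X i b → x ∈ X
  punchIn∈insertAt⁻ p = lookup⇒[]= _ _ (trans (≡-sym (insertAt-punchIn X i b x)) ([]=⇒lookup p))

∈-insertAt-true : ∀ {m} (X : Subset m) i → i ∈ insertAt X i true
∈-insertAt-true X i = lookup⇒[]= _ _ (insertAt-lookup X i true)

∉-insertAt-false : ∀ {m} (X : Subset m) i → i ∉ insertAt X i false
∉-insertAt-false X i p = contradiction (trans (≡-sym ([]=⇒lookup p)) (insertAt-lookup X i false)) λ ()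

∣insertAt-true∣ : ∀ {m} (X : Subset m) i → ∣ insertAt X i true ∣ ≡ suc ∣ X ∣
∣insertAt-true∣ X zero = refl
∣insertAt-true∣ (true ∷ X) (suc i) = cong suc (∣insertAt-true∣ X i)
∣insertAt-true∣ (false ∷ X) (suc i) = ∣insertAt-true∣ X i

∣insertAt-false∣ : ∀ {m} (X : Subset m) i → ∣ insertAt X i false ∣ ≡ ∣ X ∣
∣insertAt-false∣ X zero = refl
∣insertAt-false∣ (true ∷ X) (suc i) = cong suc (∣insertAt-false∣ X i)
∣insertAt-false∣ (false ∷ X) (suc i) = ∣insertAt-false∣ X i

x∉p-x : ∀ {m} (p : Subset m) x → x ∉ p - x
x∉p-x (_ ∷ p) zero ()
x∉p-x (_ ∷ p) (suc x) (there x∈) = x∉p-x p x x∈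

suc∣p-x∣≡∣p∣ : ∀ {m} {p : Subset m} {x} → x ∈ p → suc ∣ p - x ∣ ≡ ∣ p ∣
suc∣p-x∣≡∣p∣ {p = true ∷ p} here = cong (suc ∘ ∣_∣) (p─⊥≡p p)
suc∣p-x∣≡∣p∣ {p = true ∷ p} (there x∈p) = cong suc (suc∣p-x∣≡∣p∣ x∈p)
suc∣p-x∣≡∣p∣ {p = false ∷ p} (there x∈p) = suc∣p-x∣≡∣p∣ x∈p

¬¬-argmin : ∀ {A : Set} {P : A → Set} (f : A → ℕ) {a} → P a →
            ¬ ¬ (∃ λ b → P b × ∀ c → P c → f b ≤ f c)
¬¬-argmin {P = P} f {a} pa ¬argmin = nothingBelow (suc (f a)) pa ≤-refl
  where
  nothingBelow : ∀ k {b} → P b → f b < k → ⊥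
  nothingBelow (suc k) {b} pb (s≤s fb≤k) =
    ¬argmin (b , pb , λ c pc → ≮⇒≥ λ fc<fb → nothingBelow k pc (<-≤-trans fc<fb fb≤k))

Isolated : ∀ {n} → Graph n → Fin n → Set
Isolated K w = ∀ y → adj K w y ≡ false

CanForce : ∀ {n} → Graph n → Subset n → Set
CanForce K S = ∃₂ λ u w → u ∈ S × w ∉ S × adj K u w ≡ true × (∀ y → adj K u y ≡ true → y ≢ w → y ∈ S)

module _ {n} (K : Graph n) where

  adj⇒≢ : ∀ {u w} → adj K u w ≡ true → u ≢ w
  adj⇒≢ {u} uw refl = contradiction (trans (≡-sym uw) (irref K u)) λ ()

  isolated⇒¬adj : ∀ {u w} → Isolated K u → adj K u w ≢ true
  isolated⇒¬adj {w = w} iu uw = contradiction (trans (≡-sym uw) (iu w)) λ ()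

  isolated⇒¬adj′ : ∀ {u w} → Isolated K w → adj K u w ≢ true
  isolated⇒¬adj′ {u} {w} iw uw = isolated⇒¬adj iw (trans (sym K w u) uw)

  isolated? : ∀ w → Dec (Isolated K w)
  isolated? w = all? λ y → adj K w y ≟ᵇ false

  isolated⊎neighbour : ∀ w → Isolated K w ⊎ ∃ λ y → adj K w y ≡ true
  isolated⊎neighbour w with any? (λ y → adj K w y ≟ᵇ true)
  ... | yes neighbour = inj₂ neighbour
  ... | no ¬neighbour = inj₁ λ y → ¬-not λ wy → ¬neighbour (y , wy)

  isolated-trichotomy : (∀ w → ¬ Isolated K w)
                      ⊎ (∃ λ z → Isolated K z × ∀ w → Isolated K w → w ≡ z)
                      ⊎ (∃₂ λ z z′ → z′ ≢ z × Isolated K z × Isolated K z′)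
  isolated-trichotomy with any? isolated?
  ... | no none = inj₁ λ w iw → none (w , iw)
  ... | yes (z , iz) with any? (λ w → ¬? (w ≟ z) ×-dec isolated? w)
  ...   | yes (z′ , z′≢z , iz′) = inj₂ (inj₂ (z , z′ , z′≢z , iz , iz′))
  ...   | no onlyZ = inj₂ (inj₁ (z , iz , λ w iw → decidable-stable (w ≟ z) λ w≢z → onlyZ (w , w≢z , iw)))

  Blue-trans : ∀ {S R} → (∀ {x} → x ∈ S → Blue K R x) → ∀ {x} → Blue K S x → Blue K R x
  Blue-trans S⊆R (initial x∈S) = S⊆R x∈S
  Blue-trans S⊆R (force bu uw rest) = force (Blue-trans S⊆R bu) uw λ y uy y≢w → Blue-trans S⊆R (rest y uy y≢w)

  isolated-Blue⇒∈ : ∀ {S w} → Isolated K w → Blue K S w → w ∈ S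
  isolated-Blue⇒∈ iw (initial w∈S) = w∈S
  isolated-Blue⇒∈ iw (force bu uw rest) = contradiction uw (isolated⇒¬adj′ iw)

  Blue-minusIsolated : ∀ {S z} → Isolated K z → ∀ {x} → Blue K S x → x ≡ z ⊎ Blue K (S - z) x
  Blue-minusIsolated {z = z} iz {x} (initial x∈S) with x ≟ z
  ... | yes x≡z = inj₁ x≡z
  ... | no x≢z = inj₂ (initial (x∈p∧x≢y⇒x∈p-y x∈S x≢z))
  Blue-minusIsolated iz (force bu uw rest) with Blue-minusIsolated iz bu
  ... | inj₁ refl = contradiction uw (isolated⇒¬adj iz)
  ... | inj₂ bu′ = inj₂ (force bu′ uw λ y uy y≢w →
          [ (λ { refl → contradiction uy (isolated⇒¬adj′ iz) }) , (λ by → by) ]′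
            (Blue-minusIsolated iz (rest y uy y≢w)))

  Blue-stalled : ∀ {S} → ¬ CanForce K S → ∀ {x} → Blue K S x → x ∈ S
  Blue-stalled stalled (initial x∈S) = x∈S
  Blue-stalled {S} stalled (force {u} {w} bu uw rest) with w ∈? S
  ... | yes w∈S = w∈S
  ... | no w∉S = contradiction (u , w , Blue-stalled stalled bu , w∉S , uw , λ y uy y≢w → Blue-stalled stalled (rest y uy y≢w)) stalled

  twins-not-Blue : ∀ {S a b} → (∀ y → adj K a y ≡ adj K b y) → a ≢ b → a ∉ S → b ∉ S → ¬ Blue K S a
  twins-not-Blue twins a≢b a∉S b∉S (initial a∈S) = a∉S a∈S
  twins-not-Blue {a = a} {b} twins a≢b a∉S b∉S (force {u} bu ua rest) =
    twins-not-Blue (≡-sym ∘ twins) (a≢b ∘ ≡-sym) b∉S a∉S (rest b ub (a≢b ∘ ≡-sym))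
    where
    open ≡-Reasoning
    ub : adj K u b ≡ true
    ub = begin
      adj K u b ≡⟨ sym K u b ⟩
      adj K b u ≡⟨ ≡-sym (twins u) ⟩
      adj K a u ≡⟨ sym K a u ⟩
      adj K u a ≡⟨ ua ⟩
      true      ∎

  zfs-minus-neighbour : ∀ {R u y} → ZeroForcingSet K R → u ∈ R → adj K u y ≡ true →
                        (∀ w → adj K u w ≡ true → w ∈ R) → ZeroForcingSet K (R - y)
  zfs-minus-neighbour {R} {u} {y} zR u∈R uy N⊆R x = Blue-trans regain (zR x)
    where
    kept : ∀ {w} → w ∈ R → w ≢ y → Blue K (R - y) w
    kept w∈R w≢y = initial (x∈p∧x≢y⇒x∈p-y w∈R w≢y)
    regain : ∀ {w} → w ∈ R → Blue K (R - y) w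
    regain {w} w∈R with w ≟ y
    ... | no w≢y = kept w∈R w≢y
    ... | yes refl = force (kept u∈R (adj⇒≢ uy)) uy λ w′ uw′ w′≢y → kept (N⊆R w′ uw′) w′≢y

  minimum-isMinimal : ∀ {k S} → ZeroForcingSet K S → ∣ S ∣ ≡ k →
                      (∀ T → ZeroForcingSet K T → k ≤ ∣ T ∣) → MinimalZeroForcingSet K S
  minimum-isMinimal zS refl least = zS , λ T T⊂S zT → <⇒≱ (p⊂q⇒∣p∣<∣q∣ T⊂S) (least T zT)

  Z≡Zbar⇒minimal≤zfs : (∀ k → IsZ K k → IsZbar K k) → ∀ {S T} →
                       ZeroForcingSet K S → MinimalZeroForcingSet K T → ∣ T ∣ ≤ ∣ S ∣
  Z≡Zbar⇒minimal≤zfs Z≡Zbar {S} {T} zS mT = decidable-stable (∣ T ∣ ≤? ∣ S ∣) λ T≰S →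
    ¬¬-argmin ∣_∣ zS λ (M , zM , least) →
      T≰S (≤-trans (proj₂ (Z≡Zbar ∣ M ∣ ((M , zM , refl) , least)) T mT) (least S zS))

module Deletion {n} (G : Graph (suc n)) (v : Fin (suc n)) where

  H : Graph n
  H = deleteVertex G v

  data Vertex : Fin (suc n) → Set where
    deleted : Vertex v
    kept    : ∀ x → Vertex (punchIn v x)

  vertex : ∀ y → Vertex y
  vertex y with v ≟ y
  ... | yes refl = deleted
  ... | no v≢y = subst Vertex (punchIn-punchOut v≢y) (kept (punchOut v≢y))

  kept∈-or-isolated? : ∀ T x → Dec (punchIn v x ∈ T ⊎ Isolated H x)
  kept∈-or-isolated? T x = (punchIn v x ∈? T) ⊎-dec isolated? H x

  restrict : Subset (suc n) → Subset n
  restrict T = subsetOf (kept∈-or-isolated? T)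

  ∈-restrict⁺ : ∀ {T x} → punchIn v x ∈ T ⊎ Isolated H x → x ∈ restrict T
  ∈-restrict⁺ {T} = ∈-subsetOf⁺ (kept∈-or-isolated? T)

  ∈-restrict⁻ : ∀ {T x} → x ∈ restrict T → punchIn v x ∈ T ⊎ Isolated H x
  ∈-restrict⁻ {T} = ∈-subsetOf⁻ (kept∈-or-isolated? T)

  Blue-H⇒Blue-G : ∀ {T X} → Blue G T v → (∀ {x} → x ∈ X → Blue G T (punchIn v x)) →
                  ∀ {x} → Blue H X x → Blue G T (punchIn v x)
  Blue-H⇒Blue-G bv X⊆T (initial x∈X) = X⊆T x∈X
  Blue-H⇒Blue-G {T} bv X⊆T (force {u} {w} bu uw rest) = force (Blue-H⇒Blue-G bv X⊆T bu) uw others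
    where
    others : ∀ y → adj G (punchIn v u) y ≡ true → y ≢ punchIn v w → Blue G T y
    others y uy y≢w with vertex y
    ... | deleted = bv
    ... | kept y′ = Blue-H⇒Blue-G bv X⊆T (rest y′ uy (y≢w ∘ cong (punchIn v)))

  zfs-lift : ∀ {X T} → ZeroForcingSet H X → Blue G T v → (∀ {x} → x ∈ X → punchIn v x ∈ T) →
             ZeroForcingSet G T
  zfs-lift zX bv X⊆T y with vertex y
  ... | deleted = bv
  ... | kept y′ = Blue-H⇒Blue-G bv (initial ∘ X⊆T) (zX y′)

  module _ {S} (mS : MinimalZeroForcingSet H S) where

    restrict⊆ : ∀ {T F} → T ⊆ F → (∀ {x} → punchIn v x ∈ F → x ∈ S) → restrict T ⊆ S
    restrict⊆ T⊆F F⊆S x∈R with ∈-restrict⁻ x∈R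
    ... | inj₁ x∈T = F⊆S (T⊆F x∈T)
    ... | inj₂ ix = isolated-Blue⇒∈ H ix (proj₁ mS _)

  module UniversalVertex (univ : Universal G v) where

    adj-v-kept : ∀ x → adj G v (punchIn v x) ≡ true
    adj-v-kept x = univ _ (punchInᵢ≢i v x)

    adj-kept-v : ∀ x → adj G (punchIn v x) v ≡ true
    adj-kept-v x = trans (sym G _ v) (adj-v-kept x)

    Blue-restrict : ∀ {T x} → Blue G T (punchIn v x) → Blue H (restrict T) x
    Blue-restrict (initial x∈T) = initial (∈-restrict⁺ (inj₁ x∈T))
    Blue-restrict {T} {x} (force {u} bu ux rest) with vertex u
    ... | kept u′ = force (Blue-restrict {x = u′} bu) ux λ y u′y y≢x →
            Blue-restrict {x = y} (rest (punchIn v y) u′y (y≢x ∘ punchIn-injective v _ _))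
    ... | deleted with isolated⊎neighbour H x
    ...   | inj₁ ix = initial (∈-restrict⁺ (inj₂ ix))
    ...   | inj₂ (z , xz) = force (Blue-restrict {x = z} (rest (punchIn v z) (adj-v-kept z) (adj⇒≢ G zx))) zx λ y zy y≢x →
            Blue-restrict {x = y} (rest (punchIn v y) (adj-v-kept y) (y≢x ∘ punchIn-injective v _ _))
      where
      zx : adj H z x ≡ true
      zx = trans (sym H z x) xz

    restrict-zfs : ∀ {T} → ZeroForcingSet G T → ZeroForcingSet H (restrict T)
    restrict-zfs zT x = Blue-restrict (zT (punchIn v x))

    isolated-twins : ∀ {a b} → Isolated H a → Isolated H b → ∀ y → adj G (punchIn v a) y ≡ adj G (punchIn v b) y
    isolated-twins {a} {b} ia ib y with vertex y
    ... | deleted = trans (adj-kept-v a) (≡-sym (adj-kept-v b))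
    ... | kept y′ = trans (ia y′) (≡-sym (ib y′))

    isolated-forces-v : ∀ {T z} → Isolated H z → punchIn v z ∈ T → Blue G T v
    isolated-forces-v {T} {z} iz z∈T = force (initial z∈T) (adj-kept-v z) others
      where
      others : ∀ y → adj G (punchIn v z) y ≡ true → y ≢ v → Blue G T y
      others y zy y≢v with vertex y
      ... | deleted = contradiction refl y≢v
      ... | kept y′ = contradiction zy (isolated⇒¬adj H iz)

    zfs-lift-minusIsolated : ∀ {X T z} → Isolated H z → ZeroForcingSet H X → Blue G T v →
                             (∀ {x} → x ∈ X - z → punchIn v x ∈ T) → ZeroForcingSet G T
    zfs-lift-minusIsolated {X} {T} {z} iz zX bv X⊆T = blue
      where
      blue-off-z : ∀ x → x ≢ z → Blue G T (punchIn v x)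
      blue-off-z x x≢z with Blue-minusIsolated H iz (zX x)
      ... | inj₁ x≡z = contradiction x≡z x≢z
      ... | inj₂ bx = Blue-H⇒Blue-G bv (initial ∘ X⊆T) bx
      v-forces-z : ∀ y → adj G v y ≡ true → y ≢ punchIn v z → Blue G T y
      v-forces-z y vy y≢z with vertex y
      ... | deleted = contradiction refl (adj⇒≢ G vy)
      ... | kept y′ = blue-off-z y′ (y≢z ∘ cong (punchIn v))
      blue : ZeroForcingSet G T
      blue y with vertex y
      ... | deleted = bv
      ... | kept y′ with y′ ≟ z
      ...   | no y′≢z = blue-off-z y′ y′≢z
      ...   | yes refl = force bv (adj-v-kept z) v-forces-z

    canForce⇒closedNeighbourhood : ∀ {T} → v ∉ T → CanForce G T →
                                   ∃ λ u → punchIn v u ∈ T × ∀ y → adj H u y ≡ true → punchIn v y ∈ T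
    canForce⇒closedNeighbourhood v∉T (u , w , u∈T , w∉T , uw , rest) with vertex u
    ... | deleted = contradiction u∈T v∉T
    ... | kept u′ with w ≟ v
    ...   | yes refl = u′ , u∈T , λ y u′y → rest (punchIn v y) u′y (punchInᵢ≢i v y)
    ...   | no w≢v = contradiction (rest v (adj-kept-v u′) (w≢v ∘ ≡-sym)) v∉T

    module _ {S} (mS : MinimalZeroForcingSet H S) where

      ¬zfs-missing-nonIsolated : ∀ {T F x} → T ⊆ F → (∀ {y} → punchIn v y ∈ F → y ∈ S) →
                                 punchIn v x ∈ F → punchIn v x ∉ T → ¬ Isolated H x → ¬ ZeroForcingSet G T
      ¬zfs-missing-nonIsolated {T} {x = x} T⊆F F⊆S x∈F x∉T ¬ix zT =
        proj₂ mS (restrict T) (restrict⊆ mS T⊆F F⊆S , x , F⊆S x∈F , [ x∉T , ¬ix ]′ ∘ ∈-restrict⁻) (restrict-zfs zT)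

      -- The first force from T must be some u → v; then u can also regain any H-neighbour y,
      -- so restrict T - y ⊂ S is still zero forcing.
      ¬zfs-without-v : ∀ {T F} → T ⊆ F → (∀ {x} → punchIn v x ∈ F → x ∈ S) →
                       (∀ {x} → punchIn v x ∈ F → ¬ Isolated H x) → v ∉ T → ¬ ZeroForcingSet G T
      ¬zfs-without-v {T} T⊆F F⊆S noIso v∉T zT = v∉T (Blue-stalled G stalled (zT v))
        where
        stalled : ¬ CanForce G T
        stalled cf with canForce⇒closedNeighbourhood v∉T cf
        ... | u , u∈T , N⊆T with isolated⊎neighbour H u
        ...   | inj₁ iu = noIso (T⊆F u∈T) iu
        ...   | inj₂ (y , uy) =
                proj₂ mS (restrict T - y)
                  ((λ x∈ → restrict⊆ mS T⊆F F⊆S (p─q⊆p _ _ x∈)) , y , F⊆S (T⊆F (N⊆T y uy)) , x∉p-x _ y)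
                  (zfs-minus-neighbour H (restrict-zfs zT) (∈-restrict⁺ (inj₁ u∈T)) uy
                    λ w uw → ∈-restrict⁺ (inj₁ (N⊆T w uw)))

      minimal-lift : ∀ {F} → (∀ {x} → punchIn v x ∈ F → x ∈ S) → (∀ {x} → punchIn v x ∈ F → ¬ Isolated H x) →
                     ∀ T → T ⊂ F → ¬ ZeroForcingSet G T
      minimal-lift F⊆S noIso T (T⊆F , x , x∈F , x∉T) zT with v ∈? T | vertex x
      ... | no v∉T | _ = ¬zfs-without-v T⊆F F⊆S noIso v∉T zT
      ... | yes v∈T | deleted = x∉T v∈T
      ... | yes v∈T | kept x′ = ¬zfs-missing-nonIsolated T⊆F F⊆S x∈F x∉T (noIso x∈F) zT

      minimal-lift-without-v : ∀ {F z} → (∀ {x} → punchIn v x ∈ F → x ∈ S) → Isolated H z →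
                               punchIn v z ∉ F → v ∉ F → ∀ T → T ⊂ F → ¬ ZeroForcingSet G T
      minimal-lift-without-v {F} F⊆S iz z∉F v∉F T (T⊆F , x , x∈F , x∉T) zT with vertex x
      ... | deleted = v∉F x∈F
      ... | kept x′ with isolated? H x′
      ...   | no ¬ix = ¬zfs-missing-nonIsolated T⊆F F⊆S x∈F x∉T ¬ix zT
      ...   | yes ix = twins-not-Blue G (isolated-twins ix iz) (λ x≡z → z∉F (subst (_∈ F) x≡z x∈F))
                         x∉T (z∉F ∘ T⊆F) (zT _)

    record Lift (S₀ S : Subset n) : Set where
      field
        T₀ T      : Subset (suc n)
        zfs₀      : ZeroForcingSet G T₀
        minimal   : MinimalZeroForcingSet G T
        reflect-≤ : ∣ T ∣ ≤ ∣ T₀ ∣ → ∣ S ∣ ≤ ∣ S₀ ∣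

    lift-noIsolated : (∀ x → ¬ Isolated H x) → ∀ {S₀ S} →
                      ZeroForcingSet H S₀ → MinimalZeroForcingSet H S → Lift S₀ S
    lift-noIsolated noIso {S₀} {S} zS₀ mS = record
      { T₀ = insertAt S₀ v true
      ; T = insertAt S v true
      ; zfs₀ = zfs-lift zS₀ (initial (∈-insertAt-true S₀ v)) punchIn∈insertAt⁺
      ; minimal = zfs-lift (proj₁ mS) (initial (∈-insertAt-true S v)) punchIn∈insertAt⁺
                , minimal-lift mS punchIn∈insertAt⁻ (λ {x} _ → noIso x)
      ; reflect-≤ = s≤s⁻¹ ∘ subst₂ _≤_ (∣insertAt-true∣ S v) (∣insertAt-true∣ S₀ v)
      }

    lift-oneIsolated : ∀ {z} → Isolated H z → (∀ x → Isolated H x → x ≡ z) → ∀ {S₀ S} →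
                       ZeroForcingSet H S₀ → MinimalZeroForcingSet H S → Lift S₀ S
    lift-oneIsolated {z} iz onlyZ {S₀} {S} zS₀ mS = record
      { T₀ = insertAt (S₀ - z) v true
      ; T = insertAt (S - z) v true
      ; zfs₀ = zfs-lift-minusIsolated iz zS₀ (initial (∈-insertAt-true _ v)) punchIn∈insertAt⁺
      ; minimal = zfs-lift-minusIsolated iz (proj₁ mS) (initial (∈-insertAt-true _ v)) punchIn∈insertAt⁺
                , minimal-lift mS (p─q⊆p _ _ ∘ punchIn∈insertAt⁻)
                    λ {x} x∈ ix → x∉p-x S z (subst (_∈ S - z) (onlyZ x ix) (punchIn∈insertAt⁻ x∈))
      ; reflect-≤ = subst₂ _≤_ (size (proj₁ mS)) (size zS₀)
      }
      where
      size : ∀ {X} → ZeroForcingSet H X → ∣ insertAt (X - z) v true ∣ ≡ ∣ X ∣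
      size zX = trans (∣insertAt-true∣ _ v) (suc∣p-x∣≡∣p∣ (isolated-Blue⇒∈ H iz (zX _)))

    lift-twoIsolated : ∀ {z z′} → z′ ≢ z → Isolated H z → Isolated H z′ → ∀ {S₀ S} →
                       ZeroForcingSet H S₀ → MinimalZeroForcingSet H S → Lift S₀ S
    lift-twoIsolated {z} {z′} z′≢z iz iz′ {S₀} {S} zS₀ mS = record
      { T₀ = insertAt (S₀ - z) v false
      ; T = insertAt (S - z) v false
      ; zfs₀ = zfs-lift-minusIsolated iz zS₀ (v-blue zS₀) punchIn∈insertAt⁺
      ; minimal = zfs-lift-minusIsolated iz (proj₁ mS) (v-blue (proj₁ mS)) punchIn∈insertAt⁺
                , minimal-lift-without-v mS (p─q⊆p _ _ ∘ punchIn∈insertAt⁻) iz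
                    (x∉p-x S z ∘ punchIn∈insertAt⁻) (∉-insertAt-false _ v)
      ; reflect-≤ = subst₂ _≤_ (size (proj₁ mS)) (size zS₀) ∘ s≤s
      }
      where
      v-blue : ∀ {X} → ZeroForcingSet H X → Blue G (insertAt (X - z) v false) v
      v-blue zX = isolated-forces-v iz′ (punchIn∈insertAt⁺ (x∈p∧x≢y⇒x∈p-y (isolated-Blue⇒∈ H iz′ (zX _)) z′≢z))
      size : ∀ {X} → ZeroForcingSet H X → suc ∣ insertAt (X - z) v false ∣ ≡ ∣ X ∣
      size zX = trans (cong suc (∣insertAt-false∣ _ v)) (suc∣p-x∣≡∣p∣ (isolated-Blue⇒∈ H iz (zX _)))

    lift : ∀ {S₀ S} → ZeroForcingSet H S₀ → MinimalZeroForcingSet H S → Lift S₀ S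
    lift with isolated-trichotomy H
    ... | inj₁ noIso = lift-noIsolated noIso
    ... | inj₂ (inj₁ (z , iz , onlyZ)) = lift-oneIsolated iz onlyZ
    ... | inj₂ (inj₂ (z , z′ , z′≢z , iz , iz′)) = lift-twoIsolated z′≢z iz iz′

theorem3p6 : ∀ {n} (G : Graph (suc n)) (v : Fin (suc n)) → Universal G v →
    (∀ k → IsZ G k → IsZbar G k) →
    ∀ m → IsZ (deleteVertex G v) m → IsZbar (deleteVertex G v) m
theorem3p6 G v univ Z≡Zbar m ((S₀ , zS₀ , ∣S₀∣≡m) , least) =
  (S₀ , minimum-isMinimal H zS₀ ∣S₀∣≡m least , ∣S₀∣≡m) , noLarger
  where
  open Deletion G v
  open UniversalVertex univ
  noLarger : ∀ S → MinimalZeroForcingSet H S → ∣ S ∣ ≤ m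
  noLarger S mS = subst (∣ S ∣ ≤_) ∣S₀∣≡m (reflect-≤ (Z≡Zbar⇒minimal≤zfs G Z≡Zbar zfs₀ minimal))
    where open Lift (lift zS₀ mS)
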